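{- Let $(A,\mathrm{Con},\vdash,\Delta)$ be an information system with witnesses, $\mathfrak{X}$ a finite subset of $\mathrm{Con}$, and $(a,S),(c,T)\in\mathrm{Con}$ such that $(a,S)\vdash T$ and $a\sim c\,[T]$. Then $\mathrm{Cl}((c,T),\mathfrak{X})\subseteq\mathrm{Cl}((a,S),\mathfrak{X})$.
   Context: An information system with witnesses is a tuple $(A,\mathrm{Con},\vdash,\Delta)$ where $A$ is a set, $\Delta\in A$, $\mathrm{Con}\subseteq A\times\mathcal{P}_f(A)$ and ${\vdash}\subseteq \mathrm{Con}\times A$. Write $X\in\mathrm{Con}(i)$ for $(i,X)\in\mathrm{Con}$; $(i,X)\vdash Y$ means $(i,X)\vdash c$ for all $c\in Y$; $(i,X)\vdash(j,Y)$ means $(i,X)\vdash j$ and $(i,X)\vdash Y$. Required for all $i,j,a\in A$ and finite $X,Y\subseteq A$: (1) $\{i\}\in\mathrm{Con}(i)$; (2) $Y\subseteq X\wedge X\in\mathrm{Con}(i)\Rightarrow Y\in\mathrm{Con}(i)$; (3) $(i,\emptyset)\vdash\Delta$; (4) $X\in\mathrm{Con}(i)\wedge(i,X)\vdash Y\Rightarrow Y\in\mathrm{Con}(i)$; (5) $X,Y\in\mathrm{Con}(i)\wedge X\subseteq Y\wedge(i,X)\vdash a\Rightarrow(i,Y)\vdash a$; (6) $X\in\mathrm{Con}(i)\wedge(i,X)\vdash Y\wedge(i,Y)\vdash a\Rightarrow(i,X)\vdash a$; (7) $(i,X)\vdash a\Rightarrow\exists Z\in\mathrm{Con}(i)\,[(i,X)\vdash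 Z\wedge(i,Z)\vdash a]$; (8) $(i,X)\vdash Y\Rightarrow\exists e\in A\,[(i,X)\vdash e\wedge Y\in\mathrm{Con}(e)]$; (9) $\{i\}\in\mathrm{Con}(j)\Rightarrow\mathrm{Con}(i)\subseteq\mathrm{Con}(j)$; (10) $\{i\}\in\mathrm{Con}(j)\wedge X\in\mathrm{Con}(i)\wedge(i,X)\vdash a\Rightarrow(j,X)\vdash a$; (11) $\{i\}\in\mathrm{Con}(j)\wedge X\in\mathrm{Con}(i)\wedge(j,X)\vdash a\Rightarrow(i,X)\vdash a$. $X$-equivalence: for finite $X\subseteq A$ and $i,j\in A$, $i\sim j\,[X]$ holds if there are $n\in\omega$ and $k_1,\dots,k_n,a_0,\dots,a_n\in A$ with $a_0=i$, $a_n=j$, and for $\nu=1,\dots,n$: $X\in\mathrm{Con}(a_{\nu-1})\cap\mathrm{Con}(a_\nu)$ and $\{a_{\nu-1}\},\{a_\nu\}\in\mathrm{Con}(k_\nu)$. For finite $\mathfrak{X}\subseteq\mathrm{Con}$ and $(a,S)\in\mathrm{Con}$: $\mathrm{Cl}((a,S),\mathfrak{X})=\{(i,X)\in\mathfrak{X}\mid \exists j\in A\,[\,i\sim j\,[X]\wedge(a,S)\vdash(j,X)\,]\}$. -}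

module Defs where

open import Level using (Level; _⊔_) renaming (suc to lsuc)
open import Data.List using (List; []; _∷_)
open import Data.List.Membership.Propositional using (_∈_)
open import Data.List.Relation.Binary.Subset.Propositional using (_⊆_)
open import Data.List.Relation.Unary.All using (All)
open import Data.Nat using (ℕ; zero; suc)
open import Data.Fin using (Fin; inject₁; fromℕ) renaming (suc to fsuc)
open import Data.Product using (Σ; ∃; ∃-syntax; _×_; _,_)
open import Relation.Binary.PropositionalEquality using (_≡_)

-- Finite subsets of A are represented by lists (duplicates/order irrelevant:
-- Con is closed under ⊆ by axiom (2), so it respects set-equality of lists).

record InfoSysW (ℓ : Level) : Set (lsuc ℓ) where
  field
    A   : Set ℓ
    Con : A → List A → Set ℓ
    _⊢_▷_ : A → List A → A → Set ℓ        -- i ⊢ X ▷ a  means  (i,X) ⊢ a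
    Δ   : A
    ⊢-Con : ∀ {i X a} → i ⊢ X ▷ a → Con i X

  _⊢_▷*_ : A → List A → List A → Set ℓ
  i ⊢ X ▷* Y = All (i ⊢ X ▷_) Y

  field
    ax1  : ∀ i → Con i (i ∷ [])
    ax2  : ∀ {i X Y} → Y ⊆ X → Con i X → Con i Y
    ax3  : ∀ i → i ⊢ [] ▷ Δ
    ax4  : ∀ {i X Y} → Con i X → i ⊢ X ▷* Y → Con i Y
    ax5  : ∀ {i X Y a} → Con i X → Con i Y → X ⊆ Y → i ⊢ X ▷ a → i ⊢ Y ▷ a
    ax6  : ∀ {i X Y a} → Con i X → i ⊢ X ▷* Y → i ⊢ Y ▷ a → i ⊢ X ▷ a
    ax7  : ∀ {i X a} → i ⊢ X ▷ a → ∃[ Z ] (Con i Z × i ⊢ X ▷* Z × i ⊢ Z ▷ a)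
    ax8  : ∀ {i X Y} → i ⊢ X ▷* Y → ∃[ e ] (i ⊢ X ▷ e × Con e Y)
    ax9  : ∀ {i j} → Con j (i ∷ []) → ∀ {X} → Con i X → Con j X
    ax10 : ∀ {i j X a} → Con j (i ∷ []) → Con i X → i ⊢ X ▷ a → j ⊢ X ▷ a
    ax11 : ∀ {i j X a} → Con j (i ∷ []) → Con i X → j ⊢ X ▷ a → i ⊢ X ▷ a

  _⊢_▷⟨_,_⟩ : A → List A → A → List A → Set ℓ
  i ⊢ X ▷⟨ j , Y ⟩ = (i ⊢ X ▷ j) × (i ⊢ X ▷* Y)

  _∼_[_] : A → A → List A → Set ℓ
  i ∼ j [ X ] =
    Σ ℕ λ n → Σ (Fin (suc n) → A) λ a → Σ (Fin n → A) λ k →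
      (a Data.Fin.zero ≡ i) × (a (fromℕ n) ≡ j) ×
      (∀ (ν : Fin n) →
          Con (a (inject₁ ν)) X × Con (a (fsuc ν)) X ×
          Con (k ν) (a (inject₁ ν) ∷ []) × Con (k ν) (a (fsuc ν) ∷ []))

  FinSubCon : Set ℓ
  FinSubCon = Σ (List (A × List A)) (All (λ { (i , X) → Con i X }))

  InCl : A → List A → List (A × List A) → A → List A → Set ℓ
  InCl a S 𝔛 i X = ((i , X) ∈ 𝔛) × ∃[ j ] (i ∼ j [ X ] × a ⊢ S ▷⟨ j , X ⟩)

module Submission where

open import Defs
open import Level using (Level)
open import Data.List using (List; []; _∷_)
open import Data.List.Relation.Unary.All using () renaming (map to All-map)
open import Data.Nat using (ℕ; zero; suc)
open import Data.Fin using (Fin; inject₁; fromℕ) renaming (suc to fsuc; zero to fzero)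
open import Data.Product using (_×_; proj₁; _,_)
open import Relation.Binary.PropositionalEquality using (refl)

-- Along an X-equivalence chain, axioms (10) and (11) carry (aᵥ, X) ⊢ b back to
-- (aᵥ₋₁, X) ⊢ b through the common witness kᵥ; hence (c, T) ⊢ b gives
-- (a, T) ⊢ b, and (a, S) ⊢ T together with axiom (6) gives (a, S) ⊢ b.

module _ {ℓ : Level} (I : InfoSysW ℓ) where
  open InfoSysW I

  Links : List A → (n : ℕ) → (Fin (suc n) → A) → (Fin n → A) → Set ℓ
  Links X n f k = ∀ (ν : Fin n) →
    Con (f (inject₁ ν)) X × Con (f (fsuc ν)) X ×
    Con (k ν) (f (inject₁ ν) ∷ []) × Con (k ν) (f (fsuc ν) ∷ [])

  ⊢-link : ∀ {i j k X b} → Con i X → Con j X → Con k (i ∷ []) → Con k (j ∷ []) →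
           j ⊢ X ▷ b → i ⊢ X ▷ b
  ⊢-link i-X j-X k-i k-j j⊢b = ax11 k-i i-X (ax10 k-j j-X j⊢b)

  ⊢-chain : ∀ {X b} n (f : Fin (suc n) → A) (k : Fin n → A) → Links X n f k →
            f (fromℕ n) ⊢ X ▷ b → f fzero ⊢ X ▷ b
  ⊢-chain zero    f k links last⊢b = last⊢b
  ⊢-chain (suc n) f k links last⊢b with links fzero
  ... | i-X , j-X , k-i , k-j =
    ⊢-link i-X j-X k-i k-j
      (⊢-chain n (λ ν → f (fsuc ν)) (λ ν → k (fsuc ν)) (λ ν → links (fsuc ν)) last⊢b)

  ∼-⊢ : ∀ {i j X b} → i ∼ j [ X ] → j ⊢ X ▷ b → i ⊢ X ▷ b
  ∼-⊢ (n , f , k , refl , refl , links) = ⊢-chain n f k links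

  ⊢-∼-trans : ∀ {a S c T b} → Con a S → a ⊢ S ▷* T → a ∼ c [ T ] →
              c ⊢ T ▷ b → a ⊢ S ▷ b
  ⊢-∼-trans a-S S⊢T a∼c c⊢b = ax6 a-S S⊢T (∼-⊢ a∼c c⊢b)

lemma5p4 : ∀ {ℓ : Level} (I : InfoSysW ℓ) → let open InfoSysW I in
    (𝔛 : FinSubCon) (a : A) (S : List A) (c : A) (T : List A) →
    Con a S → Con c T → a ⊢ S ▷* T → a ∼ c [ T ] →
    ∀ (i : A) (X : List A) → InCl c T (proj₁ 𝔛) i X → InCl a S (proj₁ 𝔛) i X
lemma5p4 I 𝔛 a S c T a-S _ S⊢T a∼c i X (i,X∈𝔛 , j , i∼j , T⊢j , T⊢X) =
  i,X∈𝔛 , j , i∼j , weaken T⊢j , All-map weaken T⊢X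
  where
    open InfoSysW I
    weaken : ∀ {b} → c ⊢ T ▷ b → a ⊢ S ▷ b
    weaken = ⊢-∼-trans I a-S S⊢T a∼c
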